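{- Let $N$ be an even primitive non-deficient number, and let $a$ be the integer such that $2^a \| N$ (i.e. $2^a \mid N$ and $2^{a+1} \nmid N$). Let $R$ be the product of the distinct primes dividing $N$. Then $2^{a+1} < R$. Consequently, every even primitive non-deficient number satisfies the radical inequality.
   Context: $\sigma(n)$ is the sum of the positive divisors of $n$; $n$ is deficient if $\sigma(n) < 2n$; $n$ is primitive non-deficient if $\sigma(n) \ge 2n$ and every proper divisor of $n$ is deficient. For a positive integer $n$ with exactly $k$ distinct prime factors, let $R(n)$ be the product of the distinct primes dividing $n$. We say $n$ satisfies the radical inequality if there exist a prime $p$ and an integer $a \ge 1$ with $p^a \| n$ (i.e. $p^a \mid n$, $p^{a+1} \nmid n$) and $p^{a+1} < k R(n)$. -}

module Defs where

open import Data.Nat using (ℕ; zero; suc; _+_; _*_; _^_; _≤_; _<_; _≥_)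
open import Data.Nat.Divisibility using (_∣_; _∣?_)
open import Data.Nat.Primality using (Prime; prime?)
open import Data.List using (List; filter; length; map)
open import Data.Nat.ListAction using (sum; product)
open import Data.List.Base using (upTo)
open import Data.Product using (_×_; ∃-syntax)
open import Relation.Nullary using (¬_)

oneTo : ℕ → List ℕ
oneTo n = map suc (upTo n)

divisors : ℕ → List ℕ
divisors n = filter (_∣? n) (oneTo n)

σ : ℕ → ℕ
σ n = sum (divisors n)

Deficient : ℕ → Set
Deficient n = σ n < 2 * n

PrimitiveNonDeficient : ℕ → Set
PrimitiveNonDeficient n =
  σ n ≥ 2 * n × (∀ d → 1 ≤ d → d ∣ n → d < n → Deficient d)

primeDivisors : ℕ → List ℕ
primeDivisors n = filter prime? (divisors n)

rad : ℕ → ℕ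
rad n = product (primeDivisors n)

ω : ℕ → ℕ
ω n = length (primeDivisors n)

_^_∥_ : ℕ → ℕ → ℕ → Set
p ^ a ∥ n = (p ^ a) ∣ n × ¬ ((p ^ suc a) ∣ n)

RadicalInequality : ℕ → Set
RadicalInequality n =
  ∃[ p ] ∃[ a ] (Prime p × 1 ≤ a × p ^ a ∥ n × p ^ suc a < ω n * rad n)

module Submission where

-- Write N = m · 2^a with m odd (a ≥ 1 because N is even).  Since σ(2^a) = 2^(a+1) - 1,
-- a power of two is deficient, so m > 1 and m has an odd prime factor p.  If p < 2^a,
-- the proper divisor d = 2^(a-1) · p of N has the 2a distinct divisors 2^i and
-- 2^i · p (i < a), whose sum (2^a - 1)(1 + p) is at least 2^a · p = 2d, so d is
-- non-deficient — contradicting primitivity.  As p is odd, p ≠ 2^a, hence p > 2^a and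
-- R(N) ≥ 2 · p > 2^(a+1).  The radical inequality follows with the prime 2, since
-- N has at least one prime factor and so R(N) ≤ k · R(N).

open import Defs
open import Data.Nat using (ℕ; suc; _^_; _≤_; _<_)
open import Data.Nat.Divisibility using (_∣_)
open import Data.Product using (_×_)

open import Data.Nat using (zero; _+_; _*_; z≤n; s≤s; z<s; s≤s⁻¹; NonZero; >-nonZero; >-nonZero⁻¹; _≤?_)
open import Data.Nat.Properties
open import Data.Nat.Divisibility
  using (divides; _∣?_; _∣0; ∣-trans; ∣-refl; ∣1⇒≡1; ∣⇒≤; m∣m*n; n∣m*n; *-monoˡ-∣; *-cancelʳ-∣; 0∣⇒≡0)
open import Data.Nat.Primality using (Prime; prime?; prime[2]; prime⇒irreducible; prime⇒nonZero; ¬prime[1])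
open import Data.Nat.Coprimality using (Coprime; coprime-divisor)
open import Data.Nat.Primality.Factorisation using (factorise)
open import Data.Nat.ListAction using (sum; product)
open import Data.Nat.ListAction.Properties using (sum-++; product-++; sum-↭; product-↭)
open import Data.List using (List; []; _∷_; _++_; map; length)
open import Data.List.Membership.Propositional using (_∈_)
open import Data.List.Membership.Propositional.Properties
  using (∈-map⁺; ∈-map⁻; ∈-filter⁺; ∈-filter⁻; ∈-upTo⁺; ∈-++⁻; ∈-++⁺ʳ; ∈-∃++)
open import Data.List.Relation.Unary.Any using (here; there)
open import Data.List.Relation.Unary.All as All using ([]; _∷_)
open import Data.List.Relation.Unary.AllPairs using ([]; _∷_)
open import Data.List.Relation.Unary.Unique.Propositional using (Unique)
open import Data.List.Relation.Unary.Unique.Propositional.Properties using (map⁺; ++⁺; filter⁺; upTo⁺)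
open import Data.List.Relation.Binary.Subset.Propositional using (_⊆_)
open import Data.List.Relation.Binary.Permutation.Propositional using (_↭_; ↭-refl; ↭-sym; ↭-trans)
open import Data.List.Relation.Binary.Permutation.Propositional.Properties using (∈-resp-↭; ++⁺ˡ; shift)
open import Data.Product using (∃-syntax; _,_; proj₁; proj₂)
open import Data.Sum using (_⊎_; inj₁; inj₂)
open import Function using (_∘_)
open import Relation.Nullary using (¬_; yes; no; contradiction)
open import Relation.Binary.PropositionalEquality using (_≡_; _≢_; refl; sym; trans; cong; subst; module ≡-Reasoning)
open import Data.Nat.Solver using (module +-*-Solver)

∈⇒↭∷ : ∀ {x : ℕ} {ys} → x ∈ ys → ∃[ ys′ ] ys ↭ x ∷ ys′
∈⇒↭∷ {x} x∈ys with us , vs , refl ← ∈-∃++ x∈ys = us ++ vs , shift x us vs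

⊆⇒↭++ : ∀ {xs ys} → Unique xs → xs ⊆ ys → ∃[ zs ] ys ↭ xs ++ zs
⊆⇒↭++ {[]} {ys} _ _ = ys , ↭-refl
⊆⇒↭++ {x ∷ xs} {ys} (x∉xs ∷ xs!) x∷xs⊆ys
  with zs , ys↭ ← ⊆⇒↭++ xs! (x∷xs⊆ys ∘ there)
  with ∈-++⁻ xs (∈-resp-↭ ys↭ (x∷xs⊆ys (here refl)))
... | inj₁ x∈xs = contradiction refl (All.lookup x∉xs x∈xs)
... | inj₂ x∈zs with zs′ , zs↭ ← ∈⇒↭∷ x∈zs =
  zs′ , ↭-trans ys↭ (↭-trans (++⁺ˡ xs zs↭) (shift x xs zs′))

sum-mono-⊆ : ∀ {xs ys} → Unique xs → xs ⊆ ys → sum xs ≤ sum ys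
sum-mono-⊆ {xs} {ys} xs! xs⊆ys with zs , ys↭ ← ⊆⇒↭++ xs! xs⊆ys = begin
  sum xs             ≤⟨ m≤m+n (sum xs) (sum zs) ⟩
  sum xs + sum zs    ≡⟨ sum-++ xs zs ⟨
  sum (xs ++ zs)     ≡⟨ sum-↭ ys↭ ⟨
  sum ys             ∎
  where open ≤-Reasoning

product-pos : ∀ zs → (∀ {z} → z ∈ zs → 1 ≤ z) → 1 ≤ product zs
product-pos [] _ = s≤s z≤n
product-pos (z ∷ zs) pos = *-mono-≤ (pos (here refl)) (product-pos zs (pos ∘ there))

product-mono-⊆ : ∀ {xs ys} → Unique xs → xs ⊆ ys → (∀ {z} → z ∈ ys → 1 ≤ z) →
  product xs ≤ product ys
product-mono-⊆ {xs} {ys} xs! xs⊆ys pos with zs , ys↭ ← ⊆⇒↭++ xs! xs⊆ys = begin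
  product xs                 ≤⟨ m≤m*n (product xs) (product zs) {{>-nonZero zs-pos}} ⟩
  product xs * product zs    ≡⟨ product-++ xs zs ⟨
  product (xs ++ zs)         ≡⟨ product-↭ ys↭ ⟨
  product ys                 ∎
  where
  open ≤-Reasoning
  zs-pos : 1 ≤ product zs
  zs-pos = product-pos zs (pos ∘ ∈-resp-↭ (↭-sym ys↭) ∘ ∈-++⁺ʳ xs)

∈-divisors⁺ : ∀ {n d} → 1 ≤ n → d ∣ n → d ∈ divisors n
∈-divisors⁺ {suc n} {zero} _ 0∣n with () ← 0∣⇒≡0 0∣n
∈-divisors⁺ {suc n} {suc d} _ d∣n =
  ∈-filter⁺ (_∣? suc n) (∈-map⁺ suc (∈-upTo⁺ (∣⇒≤ d∣n))) d∣n

∈-divisors⁻ : ∀ {n d} → d ∈ divisors n → d ∣ n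
∈-divisors⁻ {n} = proj₂ ∘ ∈-filter⁻ (_∣? n) {xs = oneTo n}

∈-divisors-pos : ∀ {n d} → d ∈ divisors n → 1 ≤ d
∈-divisors-pos {n} d∈ with _ , _ , refl ← ∈-map⁻ suc (proj₁ (∈-filter⁻ (_∣? n) {xs = oneTo n} d∈)) =
  s≤s z≤n

divisors-unique : ∀ n → Unique (divisors n)
divisors-unique n = filter⁺ (_∣? n) (map⁺ suc-injective (upTo⁺ n))

σ-≤ : ∀ {n} ds → (∀ {d} → d ∣ n → d ∈ ds) → σ n ≤ sum ds
σ-≤ {n} ds ∣⇒∈ = sum-mono-⊆ (divisors-unique n) (∣⇒∈ ∘ ∈-divisors⁻)

σ-≥ : ∀ {n} ds → 1 ≤ n → Unique ds → (∀ {d} → d ∈ ds → d ∣ n) → sum ds ≤ σ n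
σ-≥ ds n≥1 ds! ∈⇒∣ = sum-mono-⊆ ds! (∈-divisors⁺ n≥1 ∘ ∈⇒∣)

∈-primeDivisors⁺ : ∀ {n p} → 1 ≤ n → Prime p → p ∣ n → p ∈ primeDivisors n
∈-primeDivisors⁺ n≥1 p-prime p∣n = ∈-filter⁺ prime? (∈-divisors⁺ n≥1 p∣n) p-prime

rad-≥ : ∀ {n} ps → 1 ≤ n → Unique ps → (∀ {p} → p ∈ ps → Prime p × p ∣ n) → product ps ≤ rad n
rad-≥ {n} ps n≥1 ps! prime-divisor = product-mono-⊆ ps! ps⊆ pos
  where
  ps⊆ : ps ⊆ primeDivisors n
  ps⊆ p∈ps = let p-prime , p∣n = prime-divisor p∈ps in ∈-primeDivisors⁺ n≥1 p-prime p∣n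
  pos : ∀ {z} → z ∈ primeDivisors n → 1 ≤ z
  pos = ∈-divisors-pos {n} ∘ proj₁ ∘ ∈-filter⁻ prime? {xs = divisors n}

rad-≤-ω*rad : ∀ {n p} → 1 ≤ n → Prime p → p ∣ n → rad n ≤ ω n * rad n
rad-≤-ω*rad {n} {p} n≥1 p-prime p∣n = m≤n*m (rad n) (ω n) {{>-nonZero (length-pos p∈)}}
  where
  p∈ : p ∈ primeDivisors n
  p∈ = ∈-primeDivisors⁺ n≥1 p-prime p∣n
  length-pos : ∀ {x : ℕ} {xs} → x ∈ xs → 1 ≤ length xs
  length-pos (here _) = s≤s z≤n
  length-pos (there _) = s≤s z≤n

powers : ℕ → ℕ → List ℕ
powers q zero = 1 ∷ []
powers q (suc b) = q ^ suc b ∷ powers q b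

powers-∣ : ∀ q b {x} → x ∈ powers q b → x ∣ q ^ b
powers-∣ q zero (here refl) = ∣-refl
powers-∣ q (suc b) (here refl) = ∣-refl
powers-∣ q (suc b) (there x∈) = ∣-trans (powers-∣ q b x∈) (n∣m*n q)

powers-≤ : ∀ q b {x} → 1 ≤ q → x ∈ powers q b → x ≤ q ^ b
powers-≤ q zero q≥1 (here refl) = ≤-refl
powers-≤ q (suc b) q≥1 (here refl) = ≤-refl
powers-≤ q (suc b) q≥1 (there x∈) =
  ≤-trans (powers-≤ q b q≥1 x∈) (^-monoʳ-≤ q {{>-nonZero q≥1}} (n≤1+n b))

powers-unique : ∀ q b → 1 < q → Unique (powers q b)
powers-unique q zero _ = [] ∷ []
powers-unique q (suc b) q>1 =
  All.tabulate (λ x∈ q^b+1≡x → <⇒≱ (^-monoʳ-< q q>1 (n<1+n b))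
                                   (subst (_≤ q ^ b) (sym q^b+1≡x) (powers-≤ q b (<⇒≤ q>1) x∈)))
  ∷ powers-unique q b q>1

powers-≡1-or-∣ : ∀ q b {x} → x ∈ powers q b → x ≡ 1 ⊎ q ∣ x
powers-≡1-or-∣ q zero (here refl) = inj₁ refl
powers-≡1-or-∣ q (suc b) (here refl) = inj₂ (m∣m*n (q ^ b))
powers-≡1-or-∣ q (suc b) (there x∈) = powers-≡1-or-∣ q b x∈

q*-∈-powers : ∀ q b {x} → x ∈ powers q b → q * x ∈ powers q (suc b)
q*-∈-powers q zero (here refl) = here refl
q*-∈-powers q (suc b) (here refl) = here refl
q*-∈-powers q (suc b) (there x∈) = there (q*-∈-powers q b x∈)

∣-prime-power : ∀ {p} b {d} → Prime p → d ∣ p ^ b → d ∈ powers p b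
∣-prime-power zero _ d∣1 = here (∣1⇒≡1 d∣1)
∣-prime-power {p} (suc b) {d} p-prime d∣p^b+1 with p ∣? d
... | yes (divides e d≡e*p) =
  subst (_∈ powers p (suc b)) (sym (trans d≡e*p (*-comm e p)))
        (q*-∈-powers p b (∣-prime-power b p-prime e∣p^b))
  where
  e∣p^b : e ∣ p ^ b
  e∣p^b = *-cancelʳ-∣ p {{prime⇒nonZero p-prime}}
            (subst (_∣ p ^ b * p) d≡e*p (subst (d ∣_) (*-comm p (p ^ b)) d∣p^b+1))
... | no p∤d = there (∣-prime-power b p-prime (coprime-divisor d⊥p d∣p^b+1))
  where
  d⊥p : Coprime d p
  d⊥p (c∣d , c∣p) with prime⇒irreducible p-prime c∣p
  ... | inj₁ c≡1 = c≡1
  ... | inj₂ refl = contradiction c∣d p∤d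

prime-∣-prime-power : ∀ {p q} b → Prime p → Prime q → p ∣ q ^ b → p ≡ q
prime-∣-prime-power b p-prime q-prime p∣q^b with powers-≡1-or-∣ _ b (∣-prime-power b q-prime p∣q^b)
... | inj₁ refl = contradiction p-prime ¬prime[1]
... | inj₂ q∣p with prime⇒irreducible p-prime q∣p
...   | inj₁ refl = contradiction q-prime ¬prime[1]
...   | inj₂ q≡p = sym q≡p

sum-powers-2 : ∀ b → suc (sum (powers 2 b)) ≡ 2 ^ suc b
sum-powers-2 zero = refl
sum-powers-2 (suc b) = begin
  suc (2 ^ suc b + sum (powers 2 b))   ≡⟨ +-suc (2 ^ suc b) _ ⟨
  2 ^ suc b + suc (sum (powers 2 b))   ≡⟨ cong (2 ^ suc b +_) (sum-powers-2 b) ⟩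
  2 ^ suc b + 2 ^ suc b                ≡⟨ cong (2 ^ suc b +_) (+-identityʳ (2 ^ suc b)) ⟨
  2 ^ suc (suc b)                      ∎
  where open ≡-Reasoning

sum-map-* : ∀ c xs → sum (map (_* c) xs) ≡ sum xs * c
sum-map-* c [] = refl
sum-map-* c (x ∷ xs) = trans (cong (x * c +_) (sum-map-* c xs)) (sym (*-distribʳ-+ c x (sum xs)))

-- Powers of two are deficient: σ(2^a) = 2^(a+1) - 1.
deficient-2^ : ∀ a → Deficient (2 ^ a)
deficient-2^ a = begin-strict
  σ (2 ^ a)              ≤⟨ σ-≤ (powers 2 a) (∣-prime-power a prime[2]) ⟩
  sum (powers 2 a)       <⟨ n<1+n _ ⟩
  suc (sum (powers 2 a)) ≡⟨ sum-powers-2 a ⟩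
  2 * 2 ^ a              ∎
  where open ≤-Reasoning

-- For an odd prime p < 2^(b+1), the number 2^b · p is non-deficient: its divisors
-- 2^i and 2^i · p (i ≤ b) already sum to (2^(b+1) - 1)(1 + p) ≥ 2^(b+1) · p.
nonDeficient-2^*p : ∀ b {p} → Prime p → p ≢ 2 → p < 2 ^ suc b → 2 * (2 ^ b * p) ≤ σ (2 ^ b * p)
nonDeficient-2^*p b {p} p-prime p≢2 p<2^b+1 = begin
  2 * (2 ^ b * p)        ≡⟨ *-assoc 2 (2 ^ b) p ⟨
  2 ^ suc b * p          ≡⟨ cong (_* p) (sum-powers-2 b) ⟨
  p + s * p              ≤⟨ +-monoˡ-≤ (s * p) (s≤s⁻¹ (subst (p <_) (sym (sum-powers-2 b)) p<2^b+1)) ⟩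
  s + s * p              ≡⟨ cong (s +_) (sum-map-* p (powers 2 b)) ⟨
  s + sum multiples      ≡⟨ sum-++ (powers 2 b) multiples ⟨
  sum (powers 2 b ++ multiples) ≤⟨ σ-≥ (powers 2 b ++ multiples) 2^b*p≥1 distinct divisor ⟩
  σ (2 ^ b * p)          ∎
  where
  open ≤-Reasoning
  s : ℕ
  s = sum (powers 2 b)
  multiples : List ℕ
  multiples = map (_* p) (powers 2 b)
  instance
    p≢0 : NonZero p
    p≢0 = prime⇒nonZero p-prime
  2^b*p≥1 : 1 ≤ 2 ^ b * p
  2^b*p≥1 = *-mono-≤ (m^n>0 2 b) (>-nonZero⁻¹ p)
  disjoint : ∀ {v} → ¬ (v ∈ powers 2 b × v ∈ multiples)
  disjoint (v∈powers , v∈multiples) with x , _ , refl ← ∈-map⁻ (_* p) v∈multiples =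
    p≢2 (prime-∣-prime-power b p-prime prime[2] (∣-trans (n∣m*n x) (powers-∣ 2 b v∈powers)))
  distinct : Unique (powers 2 b ++ multiples)
  distinct = ++⁺ (powers-unique 2 b (s≤s (s≤s z≤n)))
                 (map⁺ (λ {x} {y} → *-cancelʳ-≡ x y p) (powers-unique 2 b (s≤s (s≤s z≤n))))
                 disjoint
  divisor : ∀ {d} → d ∈ powers 2 b ++ multiples → d ∣ 2 ^ b * p
  divisor d∈ with ∈-++⁻ (powers 2 b) d∈
  ... | inj₁ d∈powers = ∣-trans (powers-∣ 2 b d∈powers) (m∣m*n p)
  ... | inj₂ d∈multiples with x , x∈ , refl ← ∈-map⁻ (_* p) d∈multiples = *-monoˡ-∣ p (powers-∣ 2 b x∈)

primeDivisor : ∀ m → 1 < m → ∃[ p ] Prime p × p ∣ m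
primeDivisor m m>1 with factorise m {{>-nonZero (<-trans z<s m>1)}}
... | record { factors = [] ; isFactorisation = m≡1 } = contradiction m≡1 (>⇒≢ m>1)
... | record { factors = p ∷ ps ; isFactorisation = m≡p*Πps ; factorsPrime = p-prime ∷ _ } =
  p , p-prime , divides (product ps) (trans m≡p*Πps (*-comm p (product ps)))

cofactor-∤ : ∀ {N m} q a → N ≡ m * q ^ a → ¬ q ^ suc a ∣ N → ¬ q ∣ m
cofactor-∤ q a N≡m*q^a q^a+1∤N q∣m =
  q^a+1∤N (subst (q ^ suc a ∣_) (sym N≡m*q^a) (*-monoˡ-∣ (q ^ a) q∣m))

-- A non-deficient N = m · 2^a with m odd has an odd part m > 1, hence a prime factor p ∣ m,
-- because powers of two are deficient.
nonDeficient⇒primeFactor : ∀ {N m} a → N ≡ m * 2 ^ a → 2 * N ≤ σ N → ¬ 2 ∣ m →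
  ∃[ p ] Prime p × p ∣ m
nonDeficient⇒primeFactor {m = zero} a _ _ 2∤m = contradiction (2 ∣0) 2∤m
nonDeficient⇒primeFactor {N} {m = 1} a N≡1*2^a nonDeficient _ =
  contradiction (subst (λ n → 2 * n ≤ σ n) N≡2^a nonDeficient) (<⇒≱ (deficient-2^ a))
  where
  N≡2^a : N ≡ 2 ^ a
  N≡2^a = trans N≡1*2^a (*-identityˡ (2 ^ a))
nonDeficient⇒primeFactor {m = suc (suc m)} _ _ _ _ = primeDivisor (2 + m) (s≤s (s≤s z≤n))

-- In a primitive non-deficient N = m · 2^(b+1) with m odd, every prime factor p of m
-- exceeds 2^(b+1): otherwise the proper divisor 2^b · p would be non-deficient.
cofactorPrime>2^ : ∀ {N m p} b → PrimitiveNonDeficient N → N ≡ m * 2 ^ suc b → ¬ 2 ∣ m →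
  Prime p → p ∣ m → 2 ^ suc b < p
cofactorPrime>2^ {N} {m} {p} b (_ , properDivisors-deficient) N≡m*2^b+1 2∤m p-prime p∣m@(divides k m≡k*p)
  with p ≤? 2 ^ suc b
... | no p≰2^b+1 = ≰⇒> p≰2^b+1
... | yes p≤2^b+1 =
  contradiction (nonDeficient-2^*p b p-prime p≢2 p<2^b+1) (<⇒≱ (properDivisors-deficient d d≥1 d∣N d<N))
  where
  open +-*-Solver
  p≢2 : p ≢ 2
  p≢2 refl = 2∤m p∣m
  p<2^b+1 : p < 2 ^ suc b
  p<2^b+1 = ≤∧≢⇒< p≤2^b+1 λ p≡2^b+1 →
    p≢2 (prime-∣-prime-power (suc b) p-prime prime[2] (subst (p ∣_) p≡2^b+1 ∣-refl))
  d : ℕ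
  d = 2 ^ b * p
  instance
    d≢0 : NonZero d
    d≢0 = >-nonZero (*-mono-≤ (m^n>0 2 b) (>-nonZero⁻¹ p {{prime⇒nonZero p-prime}}))
  d≥1 : 1 ≤ d
  d≥1 = >-nonZero⁻¹ d
  N≡k*2*d : N ≡ (k * 2) * d
  N≡k*2*d = trans N≡m*2^b+1 (trans (cong (_* 2 ^ suc b) m≡k*p)
    (solve 3 (λ k p t → (k :* p) :* (con 2 :* t) := (k :* con 2) :* (t :* p)) refl k p (2 ^ b)))
  d∣N : d ∣ N
  d∣N = divides (k * 2) N≡k*2*d
  k≥1 : 1 ≤ k
  k≥1 = n≢0⇒n>0 λ { refl → 2∤m (subst (2 ∣_) (sym m≡k*p) (2 ∣0)) }
  d<N : d < N
  d<N = subst (d <_) (trans (*-comm d (k * 2)) (sym N≡k*2*d)) (m<m*n d (k * 2) (*-monoˡ-≤ 2 k≥1))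

-- The main inequality: if 2^(b+1) ∥ N for a primitive non-deficient N, then R(N) ≥ 2 · p
-- for an odd prime p > 2^(b+1), so 2^(b+2) < R(N).
twoPower<rad : ∀ {N} b → 1 ≤ N → PrimitiveNonDeficient N → 2 ^ suc b ∥ N → 2 ^ suc (suc b) < rad N
twoPower<rad {N} b N≥1 pnd@(nonDeficient , _) (2^a∣N@(divides m N≡m*2^a) , 2^a+1∤N)
  with 2∤m ← cofactor-∤ 2 (suc b) N≡m*2^a 2^a+1∤N
  with p , p-prime , p∣m ← nonDeficient⇒primeFactor (suc b) N≡m*2^a nonDeficient 2∤m = begin-strict
    2 * 2 ^ suc b          <⟨ *-monoʳ-< 2 (cofactorPrime>2^ b pnd N≡m*2^a 2∤m p-prime p∣m) ⟩
    2 * p                  ≡⟨ cong (2 *_) (*-identityʳ p) ⟨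
    product (2 ∷ p ∷ [])   ≤⟨ rad-≥ (2 ∷ p ∷ []) N≥1 ((2≢p ∷ []) ∷ [] ∷ []) primeFactors ⟩
    rad N                  ∎
  where
  open ≤-Reasoning
  2≢p : 2 ≢ p
  2≢p refl = 2∤m p∣m
  primeFactors : ∀ {q} → q ∈ 2 ∷ p ∷ [] → Prime q × q ∣ N
  primeFactors (here refl) = prime[2] , ∣-trans (m∣m*n (2 ^ b)) 2^a∣N
  primeFactors (there (here refl)) = p-prime , ∣-trans p∣m (divides (2 ^ suc b) (trans N≡m*2^a (*-comm m _)))

mainTheorem5 : (N : ℕ) → 1 ≤ N → 2 ∣ N → PrimitiveNonDeficient N →
    (a : ℕ) → 2 ^ a ∥ N →
    (2 ^ suc a < rad N) × RadicalInequality N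
mainTheorem5 N N≥1 2∣N pnd zero (_ , 2∤N) = contradiction 2∣N 2∤N
mainTheorem5 N N≥1 2∣N pnd (suc b) 2^a∥N =
  2^a+1<R , 2 , suc b , prime[2] , s≤s z≤n , 2^a∥N , <-≤-trans 2^a+1<R (rad-≤-ω*rad N≥1 prime[2] 2∣N)
  where
  2^a+1<R : 2 ^ suc (suc b) < rad N
  2^a+1<R = twoPower<rad b N≥1 pnd 2^a∥N
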